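{- Let $\mu/\alpha$ and $\nu/\beta$ be skew shapes and $(\lambda/\sigma,\rho/\tau)=(\mu/\alpha,\nu/\beta)^\sim$. Then, in dominance order, (i) $\mathrm{row}(\mu/\alpha)\cup\mathrm{row}(\nu/\beta)\succeq\mathrm{row}(\lambda/\sigma)\cup\mathrm{row}(\rho/\tau)$, and (ii) $\mathrm{col}(\mu/\alpha)\cup\mathrm{col}(\nu/\beta)\succeq\mathrm{col}(\lambda/\sigma)\cup\mathrm{col}(\rho/\tau)$.
   Context: A skew shape $\mu/\alpha$ is given by a pair of partitions $\alpha\subseteq\mu$. For partitions $\mu,\nu$, $(\mu,\nu)^\sim=(\lambda,\rho)$ where, with $\gamma_1\ge\cdots\ge\gamma_{2p}\ge0$ the decreasing rearrangement of all parts of $\mu,\nu$ (padded with zeros), $\lambda=(\gamma_1,\gamma_3,\ldots)$, $\rho=(\gamma_2,\gamma_4,\ldots)$; equivalently $\lambda'_i=\lceil(\mu'_i+\nu'_i)/2\rceil$, $\rho'_i=\lfloor(\mu'_i+\nu'_i)/2\rfloor$. For skew shapes, $(\mu/\alpha,\nu/\beta)^\sim:=(\lambda/\sigma,\rho/\tau)$ with $(\lambda,\rho)=(\mu,\nu)^\sim$, $(\sigma,\tau)=(\alpha,\beta)^\sim$. $\mathrm{row}(\mu/\alpha)$ (resp. $\mathrm{col}(\mu/\alpha)$) is the partition whose multiset of (nonzero) parts is the multiset of row (resp. column) lengths of the diagram $\mu/\alpha$. For partitions $\mu,\nu$, $\mu\cup\nu$ is the partition obtained by the decreasing rearrangement of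 all parts of $\mu$ and $\nu$. Dominance order: for $|\mu|=|\nu|$, $\mu\preceq\nu$ iff $\mu_1+\cdots+\mu_i\le\nu_1+\cdots+\nu_i$ for all $i$. -}

module Defs where

open import Data.Nat using (ℕ; zero; suc; _+_; _∸_; _≤_; _<_; _≥_; _≤?_; _<?_)
open import Data.List using (List; []; _∷_; _++_; filter; length; map; take; upTo)
open import Data.Nat.ListAction using (sum)
open import Data.List.Relation.Unary.All using (All)
open import Data.List.Relation.Unary.Linked using (Linked)
open import Data.Product using (_×_; _,_; proj₁; proj₂)
open import Relation.Nullary using (yes; no; ¬_)
open import Relation.Nullary.Decidable using (_×-dec_)
open import Relation.Binary.PropositionalEquality using (_≡_)

IsPartition : List ℕ → Set
IsPartition μ = Linked _≥_ μ × All (λ x → 0 < x) μ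

-- i-th part (0-indexed), padded with zeros.
part : List ℕ → ℕ → ℕ
part []       _       = 0
part (x ∷ _)  zero    = x
part (_ ∷ xs) (suc i) = part xs i

-- α ⊆ μ (containment of Young diagrams), so that μ/α is a skew shape.
_⊆ₚ_ : List ℕ → List ℕ → Set
α ⊆ₚ μ = ∀ i → part α i ≤ part μ i

insertDesc : ℕ → List ℕ → List ℕ
insertDesc x [] = x ∷ []
insertDesc x (y ∷ ys) with y ≤? x
... | yes _ = x ∷ y ∷ ys
... | no  _ = y ∷ insertDesc x ys

sortDesc : List ℕ → List ℕ
sortDesc [] = []
sortDesc (x ∷ xs) = insertDesc x (sortDesc xs)

_∪ₚ_ : List ℕ → List ℕ → List ℕ
μ ∪ₚ ν = sortDesc (μ ++ ν)

-- entries in odd positions (γ₁, γ₃, …) and even positions (γ₂, γ₄, …)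
odds : List ℕ → List ℕ
evens : List ℕ → List ℕ
odds [] = []
odds (x ∷ xs) = x ∷ evens xs
evens [] = []
evens (x ∷ xs) = odds xs

-- (μ,ν)~ = (λ,ρ) ; parts are positive, so zero padding only adds trailing zeros,
-- which are not parts.
tildeL : List ℕ → List ℕ → List ℕ
tildeL μ ν = odds (μ ∪ₚ ν)

tildeR : List ℕ → List ℕ → List ℕ
tildeR μ ν = evens (μ ∪ₚ ν)

nonzero : List ℕ → List ℕ
nonzero = filter (λ x → 1 ≤? x)

rowLens : List ℕ → List ℕ → List ℕ
rowLens [] _ = []
rowLens (m ∷ μ) α = (m ∸ part α 0) ∷ rowLens μ (dropOne α)
  where
  dropOne : List ℕ → List ℕ
  dropOne [] = []
  dropOne (_ ∷ xs) = xs

row : List ℕ → List ℕ → List ℕ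
row μ α = sortDesc (nonzero (rowLens μ α))

rowPairs : List ℕ → List ℕ → List (ℕ × ℕ)
rowPairs [] _ = []
rowPairs (m ∷ μ) [] = (m , 0) ∷ rowPairs μ []
rowPairs (m ∷ μ) (a ∷ α) = (m , a) ∷ rowPairs μ α

colLen : List ℕ → List ℕ → ℕ → ℕ
colLen μ α j = length (filter (λ p → (j ≤? proj₁ p) ×-dec (proj₂ p <? j)) (rowPairs μ α))

col : List ℕ → List ℕ → List ℕ
col μ α = sortDesc (nonzero (map (λ k → colLen μ α (suc k)) (upTo (part μ 0))))

_⪯_ : List ℕ → List ℕ → Set
ν ⪯ μ = (sum ν ≡ sum μ) × (∀ i → sum (take i ν) ≤ sum (take i μ))

-- Dominance between decreasing rearrangements reduces to equal totals together with
-- Σ (xᵢ ∸ t) ≤ Σ (yᵢ ∸ t) for every threshold t: the sum of the i largest entries of a list is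
-- at most i·t + Σ (yᵢ ∸ t) for every t, with equality when t is the i-th largest entry.
--
-- With γ = μ ∪ ν and δ = α ∪ β, the rows of λ/σ and ρ/τ are the differences γᵢ ∸ δᵢ,
-- split according to the parity of i.  Pairing the decreasingly sorted first coordinates with
-- the decreasingly sorted second coordinates minimises Σ (m ∸ a ∸ t), by an exchange argument
-- run along insertion sort, so the tilde rows have the smaller excesses.
--
-- Column j of μ/α has length μ′ⱼ ∸ α′ⱼ.  A decreasing list places its parts ≥ j at
-- odd and even positions as evenly as possible, so the j-th columns of λ/σ and ρ/τ differ by at
-- most one and have the same total as those of μ/α and ν/β; by convexity of x ↦ x ∸ t such a
-- balanced pair has the smaller excess.

module Submission where

open import Defs
open import Data.List using (List; []; _∷_; _++_; [_]; filter; length; map; take; upTo)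
open import Data.List.Properties using (filter-++; filter-accept; filter-reject; length-++; map-++; map-cong; map-id; upTo-∷ʳ)
open import Data.List.Relation.Binary.Permutation.Propositional using (_↭_; ↭-refl; ↭-sym; ↭-trans; prep)
open import Data.List.Relation.Binary.Permutation.Propositional.Properties using (map⁺; filter-↭; ↭-length; ++-comm; All-resp-↭)
open import Data.List.Relation.Unary.All using (All; []; _∷_)
open import Data.List.Relation.Unary.All.Properties using (all-filter)
open import Data.List.Relation.Unary.Linked as Linked using (Linked; []; [-]; _∷_)
open import Data.Nat using (ℕ; zero; suc; _+_; _*_; _∸_; _≤_; _<_; _≥_; _≤?_; _<?_; z≤n; s≤s; pred; _≤′_; ≤′-refl; ≤′-step)
open import Data.Nat.ListAction using (sum)
open import Data.Nat.ListAction.Properties using (sum-++; sum-↭)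
open import Data.Nat.Properties
open import Data.Product using (_×_; _,_; proj₁; proj₂)
open import Data.Sum using (inj₁; inj₂)
open import Function using (_∘_)
open import Relation.Binary.PropositionalEquality using (_≡_; refl; sym; trans; cong; cong₂; subst; subst₂)
open import Relation.Binary.Properties.DecTotalOrder ≤-decTotalOrder using (≥-decTotalOrder)
open import Data.List.Sort.InsertionSort ≥-decTotalOrder using (insert; sort)
open import Data.List.Sort.InsertionSort.Properties ≥-decTotalOrder using (insert-↭; sort-↭; sort-↗)
open import Relation.Nullary using (Dec; yes; no; ¬_; contradiction)
open import Relation.Nullary.Decidable using (dec-true; dec-false; _×-dec_)
open import Algebra.Properties.CommutativeSemigroup +-commutativeSemigroup using (interchange; x∙yz≈xz∙y; xy∙z≈y∙xz)

variable
  i j k t : ℕ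
  l xs ys : List ℕ

Decreasing : List ℕ → Set
Decreasing = Linked _≥_

insertDesc≡insert : ∀ x l → insertDesc x l ≡ insert x l
insertDesc≡insert x [] = refl
insertDesc≡insert x (y ∷ l) with y ≤? x
... | yes y≤x rewrite dec-true (y ≤? x) y≤x = refl
... | no y≰x rewrite dec-false (y ≤? x) y≰x = cong (y ∷_) (insertDesc≡insert x l)

sortDesc≡sort : ∀ l → sortDesc l ≡ sort l
sortDesc≡sort [] = refl
sortDesc≡sort (x ∷ l) rewrite sortDesc≡sort l = insertDesc≡insert x (sort l)

sortDesc-↭ : ∀ l → sortDesc l ↭ l
sortDesc-↭ l = subst (_↭ l) (sym (sortDesc≡sort l)) (sort-↭ l)

sortDesc-decreasing : ∀ l → Decreasing (sortDesc l)
sortDesc-decreasing l = subst Decreasing (sym (sortDesc≡sort l)) (sort-↗ l)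

part≤head : Decreasing l → ∀ j → part l j ≤ part l 0
part≤head _           zero    = ≤-refl
part≤head []          (suc j) = z≤n
part≤head [-]         (suc j) = z≤n
part≤head (x≥y ∷ dec) (suc j) = ≤-trans (part≤head dec j) x≥y

part-antitone : Decreasing l → i ≤ j → part l j ≤ part l i
part-antitone {l = []}    _   _         = z≤n
part-antitone {l = _ ∷ _} dec (z≤n {j}) = part≤head dec j
part-antitone {l = _ ∷ _} dec (s≤s i≤j) = part-antitone (Linked.tail dec) i≤j

odds-decreasing : Decreasing l → Decreasing (odds l)
odds-decreasing {[]}              _                 = []
odds-decreasing {_ ∷ []}          _                 = [-]
odds-decreasing {_ ∷ _ ∷ []}      _                 = [-]
odds-decreasing {_ ∷ _ ∷ _ ∷ _}   (x≥y ∷ y≥z ∷ dec) = ≤-trans y≥z x≥y ∷ odds-decreasing dec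

evens-decreasing : Decreasing l → Decreasing (evens l)
evens-decreasing {[]}    _   = []
evens-decreasing {_ ∷ _} dec = odds-decreasing (Linked.tail dec)

odds++evens-↭ : ∀ l → odds l ++ evens l ↭ l
odds++evens-↭ []      = ↭-refl
odds++evens-↭ (x ∷ l) = prep x (↭-trans (++-comm (evens l) (odds l)) (odds++evens-↭ l))

part-odds : ∀ l i → part (odds l) i ≡ part l (i + i)
part-evens : ∀ l i → part (evens l) i ≡ part l (suc (i + i))
part-odds []      i       = refl
part-odds (x ∷ l) zero    = refl
part-odds (x ∷ l) (suc i) = trans (part-evens l i) (cong (part l) (sym (+-suc i i)))
part-evens []      i = refl
part-evens (x ∷ l) i = part-odds l i

odds-mono-⊆ₚ : ∀ δ γ → δ ⊆ₚ γ → odds δ ⊆ₚ odds γ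
odds-mono-⊆ₚ δ γ δ⊆γ i rewrite part-odds δ i | part-odds γ i = δ⊆γ (i + i)

evens-mono-⊆ₚ : ∀ δ γ → δ ⊆ₚ γ → evens δ ⊆ₚ evens γ
evens-mono-⊆ₚ δ γ δ⊆γ i rewrite part-evens δ i | part-evens γ i = δ⊆γ (suc (i + i))

-- Dominance through excesses over thresholds

excess : ℕ → List ℕ → ℕ
excess t l = sum (map (_∸ t) l)

excess-↭ : ∀ t → xs ↭ ys → excess t xs ≡ excess t ys
excess-↭ t p = sum-↭ (map⁺ (_∸ t) p)

excess-++ : ∀ t xs ys → excess t (xs ++ ys) ≡ excess t xs + excess t ys
excess-++ t xs ys = trans (cong sum (map-++ (_∸ t) xs ys)) (sum-++ (map (_∸ t) xs) _)

excess-zero : ∀ l → excess 0 l ≡ sum l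
excess-zero l = cong sum (map-id l)

excess-nonzero : ∀ t l → excess t (nonzero l) ≡ excess t l
excess-nonzero t []          = refl
excess-nonzero t (zero ∷ l)  = trans (excess-nonzero t l) (cong (_+ excess t l) (sym (0∸n≡0 t)))
excess-nonzero t (suc x ∷ l) = cong (suc x ∸ t +_) (excess-nonzero t l)

excess≡0 : ∀ l → (∀ j → part l j ≤ t) → excess t l ≡ 0
excess≡0 []      _     = refl
excess≡0 (x ∷ l) below = cong₂ _+_ (m≤n⇒m∸n≡0 (below 0)) (excess≡0 l (λ j → below (suc j)))

sum-take≤ : ∀ i l → sum (take i l) ≤ i * t + excess t l
sum-take≤         zero    l       = z≤n
sum-take≤         (suc i) []      = z≤n
sum-take≤ {t = t} (suc i) (x ∷ l) = begin
  x + sum (take i l)                     ≤⟨ +-mono-≤ (m≤n+m∸n x t) (sum-take≤ i l) ⟩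
  (t + (x ∸ t)) + (i * t + excess t l)   ≡⟨ interchange t (x ∸ t) (i * t) (excess t l) ⟩
  (t + i * t) + ((x ∸ t) + excess t l)   ∎
  where open ≤-Reasoning

sum-take≥ : ∀ i l → (∀ j → j < i → t ≤ part l j) → (∀ j → i ≤ j → part l j ≤ t) →
            i * t + excess t l ≤ sum (take i l)
sum-take≥         zero    l       _     below = ≤-reflexive (excess≡0 l (λ j → below j z≤n))
sum-take≥         (suc i) []      above _     rewrite n≤0⇒n≡0 (above 0 (s≤s z≤n)) | *-zeroʳ i = z≤n
sum-take≥ {t = t} (suc i) (x ∷ l) above below = begin
  (t + i * t) + ((x ∸ t) + excess t l)  ≡⟨ interchange t (i * t) (x ∸ t) (excess t l) ⟩
  (t + (x ∸ t)) + (i * t + excess t l)  ≤⟨ +-mono-≤ (≤-reflexive (m+[n∸m]≡n (above 0 (s≤s z≤n))))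
                                                   (sum-take≥ i l (λ j j<i → above (suc j) (s≤s j<i))
                                                                  (λ j i≤j → below (suc j) (s≤s i≤j))) ⟩
  x + sum (take i l)                    ∎
  where open ≤-Reasoning

⪯-from-excess : ∀ xs ys → sum xs ≡ sum ys → (∀ t → excess t xs ≤ excess t ys) → sortDesc xs ⪯ sortDesc ys
⪯-from-excess xs ys sum≡ excess≤ =
  trans (sum-↭ (sortDesc-↭ xs)) (trans sum≡ (sym (sum-↭ (sortDesc-↭ ys)))) , prefix≤
  where
  prefix≤ : ∀ i → sum (take i (sortDesc xs)) ≤ sum (take i (sortDesc ys))
  prefix≤ i = begin
    sum (take i (sortDesc xs))        ≤⟨ sum-take≤ i (sortDesc xs) ⟩
    i * s + excess s (sortDesc xs)    ≡⟨ cong (i * s +_) (excess-↭ s (sortDesc-↭ xs)) ⟩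
    i * s + excess s xs               ≤⟨ +-monoʳ-≤ (i * s) (excess≤ s) ⟩
    i * s + excess s ys               ≡⟨ cong (i * s +_) (excess-↭ s (sortDesc-↭ ys)) ⟨
    i * s + excess s (sortDesc ys)    ≤⟨ sum-take≥ i (sortDesc ys)
                                           (λ j j<i → part-antitone dec (<⇒≤pred j<i))
                                           (λ j i≤j → part-antitone dec (≤-trans pred[n]≤n i≤j)) ⟩
    sum (take i (sortDesc ys))        ∎
    where
    open ≤-Reasoning
    dec : Decreasing (sortDesc ys)
    dec = sortDesc-decreasing ys
    s : ℕ
    s = part (sortDesc ys) (pred i)

∸-split : ∀ {x p q} → q ≤ p → p ≤ x → x ∸ q ≡ (x ∸ p) + (p ∸ q)
∸-split {x} {p} {q} q≤p p≤x = trans (cong (_∸ q) (sym (m∸n+n≡m p≤x))) (+-∸-assoc (x ∸ p) q≤p)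

∸-exchange : ∀ {a b p q} → b ≤ a → q ≤ p → (a ∸ p) + (b ∸ q) ≤ (a ∸ q) + (b ∸ p)
∸-exchange {a} {b} {p} {q} b≤a q≤p with ≤-total p b
... | inj₁ p≤b = ≤-reflexive (begin-equality
  (a ∸ p) + (b ∸ q)                ≡⟨ cong ((a ∸ p) +_) (∸-split q≤p p≤b) ⟩
  (a ∸ p) + ((b ∸ p) + (p ∸ q))    ≡⟨ x∙yz≈xz∙y (a ∸ p) (b ∸ p) (p ∸ q) ⟩
  ((a ∸ p) + (p ∸ q)) + (b ∸ p)    ≡⟨ cong (_+ (b ∸ p)) (∸-split q≤p (≤-trans p≤b b≤a)) ⟨
  (a ∸ q) + (b ∸ p)                ∎)
  where open ≤-Reasoning
... | inj₂ b≤p rewrite m≤n⇒m∸n≡0 b≤p | +-identityʳ (a ∸ q) with ≤-total p a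
...   | inj₁ p≤a = begin
  (a ∸ p) + (b ∸ q)   ≤⟨ +-monoʳ-≤ (a ∸ p) (∸-monoˡ-≤ q b≤p) ⟩
  (a ∸ p) + (p ∸ q)   ≡⟨ ∸-split q≤p p≤a ⟨
  a ∸ q               ∎
  where open ≤-Reasoning
...   | inj₂ a≤p rewrite m≤n⇒m∸n≡0 a≤p = ∸-monoˡ-≤ q b≤a

∸-convex : ∀ {n₁ n₂ o₁ o₂} t → n₁ + n₂ ≡ o₁ + o₂ → n₁ ≤ o₁ → n₂ ≤ o₁ →
           (n₁ ∸ t) + (n₂ ∸ t) ≤ (o₁ ∸ t) + (o₂ ∸ t)
∸-convex {n₁} {n₂} {o₁} {o₂} t sum≡ n₁≤o₁ n₂≤o₁ = begin
  (n₁ ∸ t) + (n₂ ∸ t)          ≡⟨ cong (_+ (n₂ ∸ t)) o₁-shift ⟨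
  (o₁ ∸ (d + t)) + (n₂ ∸ t)    ≤⟨ ∸-exchange n₂≤o₁ (m≤n+m t d) ⟩
  (o₁ ∸ t) + (n₂ ∸ (d + t))    ≡⟨ cong ((o₁ ∸ t) +_) n₂-shift ⟩
  (o₁ ∸ t) + (o₂ ∸ t)          ∎
  where
  open ≤-Reasoning
  d : ℕ
  d = o₁ ∸ n₁
  o₁-shift : o₁ ∸ (d + t) ≡ n₁ ∸ t
  o₁-shift = trans (sym (∸-+-assoc o₁ d t)) (cong (_∸ t) (m∸[m∸n]≡n n₁≤o₁))
  n₂≡d+o₂ : n₂ ≡ d + o₂
  n₂≡d+o₂ = +-cancelˡ-≡ n₁ n₂ (d + o₂) (begin-equality
    n₁ + n₂          ≡⟨ sum≡ ⟩
    o₁ + o₂          ≡⟨ cong (_+ o₂) (m+[n∸m]≡n n₁≤o₁) ⟨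
    (n₁ + d) + o₂    ≡⟨ +-assoc n₁ d o₂ ⟩
    n₁ + (d + o₂)    ∎)
  n₂-shift : n₂ ∸ (d + t) ≡ o₂ ∸ t
  n₂-shift = trans (cong (_∸ (d + t)) n₂≡d+o₂) ([m+n]∸[m+o]≡n∸o d o₂ t)

near-balanced≤max : ∀ {a b o₁ o₂} → a + b ≡ o₁ + o₂ → a ≤ suc b → o₂ ≤ o₁ → a ≤ o₁
near-balanced≤max {a} {b} {o₁} {o₂} sum≡ a≤1+b o₂≤o₁ with a ≤? o₁
... | yes a≤o₁ = a≤o₁
... | no a≰o₁ = contradiction (sym sum≡) (<⇒≢ (begin-strict
  o₁ + o₂   <⟨ +-mono-<-≤ o₁<a (≤-trans o₂≤o₁ (≤-pred (≤-trans o₁<a a≤1+b))) ⟩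
  a + b     ∎))
  where
  open ≤-Reasoning
  o₁<a : o₁ < a
  o₁<a = ≰⇒> a≰o₁

∸-near-balanced : ∀ {n₁ n₂ o₁ o₂} t → n₁ + n₂ ≡ o₁ + o₂ → n₁ ≤ suc n₂ → n₂ ≤ suc n₁ →
                  (n₁ ∸ t) + (n₂ ∸ t) ≤ (o₁ ∸ t) + (o₂ ∸ t)
∸-near-balanced {n₁} {n₂} {o₁} {o₂} t sum≡ n₁≤1+n₂ n₂≤1+n₁ with ≤-total o₂ o₁
... | inj₁ o₂≤o₁ = ∸-convex t sum≡ (near-balanced≤max sum≡ n₁≤1+n₂ o₂≤o₁)
                                   (near-balanced≤max (trans (+-comm n₂ n₁) sum≡) n₂≤1+n₁ o₂≤o₁)
... | inj₂ o₁≤o₂ = subst ((n₁ ∸ t) + (n₂ ∸ t) ≤_) (+-comm (o₂ ∸ t) (o₁ ∸ t))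
  (∸-convex t sum≡′ (near-balanced≤max sum≡′ n₁≤1+n₂ o₁≤o₂)
                    (near-balanced≤max (trans (+-comm n₂ n₁) sum≡′) n₂≤1+n₁ o₁≤o₂))
  where
  sum≡′ : n₁ + n₂ ≡ o₂ + o₁
  sum≡′ = trans sum≡ (+-comm o₁ o₂)

differences-near-balanced : ∀ n₁ n₂ s₁ s₂ {l₁ l₂} →
  n₁ + s₁ ≡ l₁ → n₂ + s₂ ≡ l₂ → l₂ ≤ l₁ → l₁ ≤ suc l₂ → s₂ ≤ s₁ → s₁ ≤ suc s₂ →
  n₁ ≤ suc n₂ × n₂ ≤ suc n₁
differences-near-balanced n₁ n₂ s₁ s₂ {l₁} {l₂} e₁ e₂ l₂≤l₁ l₁≤1+l₂ s₂≤s₁ s₁≤1+s₂ =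
  +-cancelʳ-≤ s₁ n₁ (suc n₂) (begin
    n₁ + s₁          ≡⟨ e₁ ⟩
    l₁               ≤⟨ l₁≤1+l₂ ⟩
    suc l₂           ≡⟨ cong suc e₂ ⟨
    suc (n₂ + s₂)    ≤⟨ s≤s (+-monoʳ-≤ n₂ s₂≤s₁) ⟩
    suc n₂ + s₁      ∎) ,
  +-cancelʳ-≤ s₂ n₂ (suc n₁) (begin
    n₂ + s₂          ≡⟨ e₂ ⟩
    l₂               ≤⟨ l₂≤l₁ ⟩
    l₁               ≡⟨ e₁ ⟨
    n₁ + s₁          ≤⟨ +-monoʳ-≤ n₁ s₁≤1+s₂ ⟩
    n₁ + suc s₂      ≡⟨ +-suc n₁ s₂ ⟩
    suc n₁ + s₂      ∎)
  where open ≤-Reasoning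

-- Conjugate parts and column lengths

conj : List ℕ → ℕ → ℕ
conj l j = length (filter (j ≤?_) l)

conj-↭ : ∀ j → xs ↭ ys → conj xs j ≡ conj ys j
conj-↭ j p = ↭-length (filter-↭ (j ≤?_) p)

conj-++ : ∀ j xs ys → conj (xs ++ ys) j ≡ conj xs j + conj ys j
conj-++ j xs ys = trans (cong length (filter-++ (j ≤?_) xs ys)) (length-++ (filter (j ≤?_) xs))

conj-∷-accept : ∀ x xs → j ≤ x → conj (x ∷ xs) j ≡ suc (conj xs j)
conj-∷-accept {j} x xs j≤x = cong length (filter-accept (j ≤?_) {xs = xs} j≤x)

conj-∷-reject : ∀ x xs → x < j → conj (x ∷ xs) j ≡ conj xs j
conj-∷-reject {j} x xs x<j = cong length (filter-reject (j ≤?_) {xs = xs} (<⇒≱ x<j))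

conj-∷≤ : ∀ x xs → conj (x ∷ xs) j ≤ suc (conj xs j)
conj-∷≤ {j} x xs with j ≤? x
... | yes j≤x = ≤-reflexive (conj-∷-accept x xs j≤x)
... | no j≰x  = ≤-trans (≤-reflexive (conj-∷-reject x xs (≰⇒> j≰x))) (n≤1+n _)

part<⇒conj≤ : Decreasing l → part l k < j → conj l j ≤ k
part<⇒conj≤ {[]}     _   _ = z≤n
part<⇒conj≤ {x ∷ xs} {zero} {j} dec x<j = begin
  conj (x ∷ xs) j   ≡⟨ conj-∷-reject x xs x<j ⟩
  conj xs j         ≤⟨ part<⇒conj≤ (Linked.tail dec) (≤-<-trans (part≤head dec 1) x<j) ⟩
  0                 ∎
  where open ≤-Reasoning
part<⇒conj≤ {x ∷ xs} {suc k} dec part<j =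
  ≤-trans (conj-∷≤ x xs) (s≤s (part<⇒conj≤ (Linked.tail dec) part<j))

≤part⇒<conj : Decreasing l → 0 < j → j ≤ part l k → k < conj l j
≤part⇒<conj {[]} {suc _} _ _ ()
≤part⇒<conj {x ∷ xs} {k = zero}  _   _   j≤x = ≤-<-trans z≤n (≤-reflexive (sym (conj-∷-accept x xs j≤x)))
≤part⇒<conj {x ∷ xs} {j} {suc k} dec 0<j j≤part = begin-strict
  suc k                <⟨ s≤s (≤part⇒<conj (Linked.tail dec) 0<j j≤part) ⟩
  suc (conj xs j)      ≡⟨ conj-∷-accept x xs (≤-trans j≤part (part≤head dec (suc k))) ⟨
  conj (x ∷ xs) j      ∎
  where open ≤-Reasoning

conj-vanishes : Decreasing l → part l 0 ≤ k → conj l (suc k) ≡ 0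
conj-vanishes dec head≤k = n≤0⇒n≡0 (part<⇒conj≤ dec (s≤s head≤k))

⊆ₚ-from-conj : ∀ {α μ} → Decreasing μ → Decreasing α →
               (∀ j → 0 < j → conj α j ≤ conj μ j) → α ⊆ₚ μ
⊆ₚ-from-conj {α} {μ} decμ decα conj≤ k with part α k ≤? part μ k
... | yes α≤μ = α≤μ
... | no α≰μ = contradiction (≤part⇒<conj decα 0<v ≤-refl) (≤⇒≯ (begin
  conj α v   ≤⟨ conj≤ v 0<v ⟩
  conj μ v   ≤⟨ part<⇒conj≤ decμ μ<v ⟩
  k          ∎))
  where
  open ≤-Reasoning
  v : ℕ
  v = part α k
  μ<v : part μ k < v
  μ<v = ≰⇒> α≰μ
  0<v : 0 < v
  0<v = ≤-<-trans z≤n μ<v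

inColumn? : ∀ j (p : ℕ × ℕ) → Dec ((j ≤ proj₁ p) × (proj₂ p < j))
inColumn? j p = (j ≤? proj₁ p) ×-dec (proj₂ p <? j)

colLen-∷-accept : ∀ m a μ α → j ≤ m → a < j → colLen (m ∷ μ) (a ∷ α) j ≡ suc (colLen μ α j)
colLen-∷-accept {j} m a μ α j≤m a<j = cong length (filter-accept (inColumn? j) {xs = rowPairs μ α} (j≤m , a<j))

colLen-∷-reject : ∀ m a μ α → ¬ ((j ≤ m) × (a < j)) → colLen (m ∷ μ) (a ∷ α) j ≡ colLen μ α j
colLen-∷-reject {j} m a μ α ∉ = cong length (filter-reject (inColumn? j) {xs = rowPairs μ α} ∉)

-- A row (m , a) with a ≤ m adds [a < j ≤ m] to the column and [j ≤ a] to α′ⱼ; together [j ≤ m].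
colLen+conj-∷ : ∀ m a μ α → a ≤ m →
  colLen μ α (suc j) + conj α (suc j) ≡ conj μ (suc j) →
  colLen (m ∷ μ) (a ∷ α) (suc j) + conj (a ∷ α) (suc j) ≡ conj (m ∷ μ) (suc j)
colLen+conj-∷ {j} m a μ α a≤m ih with suc j ≤? a | suc j ≤? m
... | yes j<a | _ = begin-equality
  colLen (m ∷ μ) (a ∷ α) (suc j) + conj (a ∷ α) (suc j)
    ≡⟨ cong₂ _+_ (colLen-∷-reject m a μ α (λ (_ , a<j) → <⇒≱ a<j j<a)) (conj-∷-accept a α j<a) ⟩
  colLen μ α (suc j) + suc (conj α (suc j))   ≡⟨ +-suc _ _ ⟩
  suc (colLen μ α (suc j) + conj α (suc j))   ≡⟨ cong suc ih ⟩
  suc (conj μ (suc j))                        ≡⟨ conj-∷-accept m μ (≤-trans j<a a≤m) ⟨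
  conj (m ∷ μ) (suc j)                        ∎
  where open ≤-Reasoning
... | no j≮a | yes j<m = begin-equality
  colLen (m ∷ μ) (a ∷ α) (suc j) + conj (a ∷ α) (suc j)
    ≡⟨ cong₂ _+_ (colLen-∷-accept m a μ α j<m (≰⇒> j≮a)) (conj-∷-reject a α (≰⇒> j≮a)) ⟩
  suc (colLen μ α (suc j) + conj α (suc j))   ≡⟨ cong suc ih ⟩
  suc (conj μ (suc j))                        ≡⟨ conj-∷-accept m μ j<m ⟨
  conj (m ∷ μ) (suc j)                        ∎
  where open ≤-Reasoning
... | no j≮a | no j≮m = begin-equality
  colLen (m ∷ μ) (a ∷ α) (suc j) + conj (a ∷ α) (suc j)
    ≡⟨ cong₂ _+_ (colLen-∷-reject m a μ α (λ (j≤m , _) → j≮m j≤m)) (conj-∷-reject a α (≰⇒> j≮a)) ⟩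
  colLen μ α (suc j) + conj α (suc j)         ≡⟨ ih ⟩
  conj μ (suc j)                              ≡⟨ conj-∷-reject m μ (≰⇒> j≮m) ⟨
  conj (m ∷ μ) (suc j)                        ∎
  where open ≤-Reasoning

conj-⊆ₚ[] : ∀ α → α ⊆ₚ [] → conj α (suc j) ≡ 0
conj-⊆ₚ[] []      _     = refl
conj-⊆ₚ[] (a ∷ α) α⊆[] =
  trans (conj-∷-reject a α (s≤s (≤-trans (α⊆[] 0) z≤n))) (conj-⊆ₚ[] α (α⊆[] ∘ suc))

-- rowPairs pads α with zeros, so α = [] is treated definitionally as α = 0 ∷ [].
colLen+conj : ∀ μ α → α ⊆ₚ μ → ∀ j → colLen μ α (suc j) + conj α (suc j) ≡ conj μ (suc j)
colLen+conj []      α       α⊆[] j = conj-⊆ₚ[] α α⊆[]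
colLen+conj (m ∷ μ) []      _    j = colLen+conj-∷ m 0 μ [] z≤n (colLen+conj μ [] (λ _ → z≤n) j)
colLen+conj (m ∷ μ) (a ∷ α) α⊆μ  j = colLen+conj-∷ m a μ α (α⊆μ 0) (colLen+conj μ α (α⊆μ ∘ suc) j)

conj-mono : ∀ {α μ} → α ⊆ₚ μ → 0 < j → conj α j ≤ conj μ j
conj-mono {suc j} {α} {μ} α⊆μ _ = subst (conj α (suc j) ≤_) (colLen+conj μ α α⊆μ j) (m≤n+m _ _)

conj-odds-evens-balanced : Decreasing l → ∀ j →
  conj (evens l) j ≤ conj (odds l) j × conj (odds l) j ≤ suc (conj (evens l) j)
conj-odds-evens-balanced {[]}    _   j = z≤n , z≤n
conj-odds-evens-balanced {x ∷ l} dec j with j ≤? x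
... | yes j≤x =
  ≤-trans odds≤1+evens (≤-reflexive (sym (conj-∷-accept x (evens l) j≤x))) ,
  ≤-trans (≤-reflexive (conj-∷-accept x (evens l) j≤x)) (s≤s evens≤odds)
  where
  evens≤odds : conj (evens l) j ≤ conj (odds l) j
  evens≤odds = proj₁ (conj-odds-evens-balanced (Linked.tail dec) j)
  odds≤1+evens : conj (odds l) j ≤ suc (conj (evens l) j)
  odds≤1+evens = proj₂ (conj-odds-evens-balanced (Linked.tail dec) j)
... | no j≰x =
  ≤-trans (part<⇒conj≤ (evens-decreasing dec) second<j) z≤n ,
  ≤-trans (part<⇒conj≤ (odds-decreasing dec) (≰⇒> j≰x)) z≤n
  where
  second<j : part (odds l) 0 < j
  second<j = ≤-<-trans (≤-trans (≤-reflexive (part-odds l 0)) (part≤head dec 1)) (≰⇒> j≰x)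

-- Skew shapes under the tilde construction

∪ₚ-mono-⊆ₚ : ∀ α β μ ν → α ⊆ₚ μ → β ⊆ₚ ν → (α ∪ₚ β) ⊆ₚ (μ ∪ₚ ν)
∪ₚ-mono-⊆ₚ α β μ ν α⊆μ β⊆ν =
  ⊆ₚ-from-conj (sortDesc-decreasing (μ ++ ν)) (sortDesc-decreasing (α ++ β)) λ j 0<j → begin
    conj (α ∪ₚ β) j          ≡⟨ conj-↭ j (sortDesc-↭ (α ++ β)) ⟩
    conj (α ++ β) j          ≡⟨ conj-++ j α β ⟩
    conj α j + conj β j      ≤⟨ +-mono-≤ (conj-mono {α = α} {μ} α⊆μ 0<j) (conj-mono {α = β} {ν} β⊆ν 0<j) ⟩
    conj μ j + conj ν j      ≡⟨ conj-++ j μ ν ⟨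
    conj (μ ++ ν) j          ≡⟨ conj-↭ j (sortDesc-↭ (μ ++ ν)) ⟨
    conj (μ ∪ₚ ν) j          ∎
  where open ≤-Reasoning

tilde-↭ : ∀ μ ν → tildeL μ ν ++ tildeR μ ν ↭ μ ++ ν
tilde-↭ μ ν = ↭-trans (odds++evens-↭ (μ ∪ₚ ν)) (sortDesc-↭ (μ ++ ν))

tildeL-mono-⊆ₚ : ∀ α β μ ν → α ⊆ₚ μ → β ⊆ₚ ν → tildeL α β ⊆ₚ tildeL μ ν
tildeL-mono-⊆ₚ α β μ ν α⊆μ β⊆ν = odds-mono-⊆ₚ (α ∪ₚ β) (μ ∪ₚ ν) (∪ₚ-mono-⊆ₚ α β μ ν α⊆μ β⊆ν)

tildeR-mono-⊆ₚ : ∀ α β μ ν → α ⊆ₚ μ → β ⊆ₚ ν → tildeR α β ⊆ₚ tildeR μ ν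
tildeR-mono-⊆ₚ α β μ ν α⊆μ β⊆ν = evens-mono-⊆ₚ (α ∪ₚ β) (μ ∪ₚ ν) (∪ₚ-mono-⊆ₚ α β μ ν α⊆μ β⊆ν)

tilde-difference-sum : ∀ (w : List ℕ → ℕ) (q : List ℕ → List ℕ → ℕ) →
  (∀ xs ys → w (xs ++ ys) ≡ w xs + w ys) → (∀ {xs ys} → xs ↭ ys → w xs ≡ w ys) →
  (∀ μ α → α ⊆ₚ μ → q μ α + w α ≡ w μ) →
  ∀ μ α ν β → α ⊆ₚ μ → β ⊆ₚ ν →
  q (tildeL μ ν) (tildeL α β) + q (tildeR μ ν) (tildeR α β) ≡ q μ α + q ν β
tilde-difference-sum w q w-++ w-↭ q+w μ α ν β α⊆μ β⊆ν = +-cancelʳ-≡ (wS + wT) _ _ (begin-equality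
  (qL + qR) + (wS + wT)          ≡⟨ interchange qL qR wS wT ⟩
  (qL + wS) + (qR + wT)          ≡⟨ cong₂ _+_ (q+w L S (tildeL-mono-⊆ₚ α β μ ν α⊆μ β⊆ν))
                                             (q+w R T (tildeR-mono-⊆ₚ α β μ ν α⊆μ β⊆ν)) ⟩
  w L + w R                      ≡⟨ tilde-w μ ν ⟩
  w μ + w ν                      ≡⟨ cong₂ _+_ (q+w μ α α⊆μ) (q+w ν β β⊆ν) ⟨
  (q μ α + w α) + (q ν β + w β)  ≡⟨ interchange (q μ α) (w α) (q ν β) (w β) ⟩
  (q μ α + q ν β) + (w α + w β)  ≡⟨ cong ((q μ α + q ν β) +_) (tilde-w α β) ⟨
  (q μ α + q ν β) + (wS + wT)    ∎)
  where
  open ≤-Reasoning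
  L R S T : List ℕ
  L = tildeL μ ν
  R = tildeR μ ν
  S = tildeL α β
  T = tildeR α β
  qL qR wS wT : ℕ
  qL = q L S
  qR = q R T
  wS = w S
  wT = w T
  tilde-w : ∀ xs ys → w (tildeL xs ys) + w (tildeR xs ys) ≡ w xs + w ys
  tilde-w xs ys = trans (sym (w-++ (tildeL xs ys) _)) (trans (w-↭ (tilde-↭ xs ys)) (w-++ xs ys))

-- Rows

diff : ℕ × ℕ → ℕ
diff (m , a) = m ∸ a

rowExcess : ℕ → List (ℕ × ℕ) → ℕ
rowExcess t P = excess t (map diff P)

rowLens≡map-diff : ∀ μ α → rowLens μ α ≡ map diff (rowPairs μ α)
rowLens≡map-diff []      α       = refl
rowLens≡map-diff (m ∷ μ) []      = cong (m ∷_) (rowLens≡map-diff μ [])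
rowLens≡map-diff (m ∷ μ) (a ∷ α) = cong (m ∸ a ∷_) (rowLens≡map-diff μ α)

rowPairs-odds++evens-↭ : ∀ γ δ → rowPairs (odds γ) (odds δ) ++ rowPairs (evens γ) (evens δ) ↭ rowPairs γ δ
rowPairs-odds++evens-↭ []      δ       = ↭-refl
rowPairs-odds++evens-↭ (g ∷ γ) []      =
  prep (g , 0) (↭-trans (++-comm (rowPairs (evens γ) []) _) (rowPairs-odds++evens-↭ γ []))
rowPairs-odds++evens-↭ (g ∷ γ) (d ∷ δ) =
  prep (g , d) (↭-trans (++-comm (rowPairs (evens γ) (evens δ)) _) (rowPairs-odds++evens-↭ γ δ))

excess-row : ∀ t μ α → excess t (row μ α) ≡ rowExcess t (rowPairs μ α)
excess-row t μ α = begin-equality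
  excess t (row μ α)                 ≡⟨ excess-↭ t (sortDesc-↭ (nonzero (rowLens μ α))) ⟩
  excess t (nonzero (rowLens μ α))   ≡⟨ excess-nonzero t (rowLens μ α) ⟩
  excess t (rowLens μ α)             ≡⟨ cong (excess t) (rowLens≡map-diff μ α) ⟩
  rowExcess t (rowPairs μ α)         ∎
  where open ≤-Reasoning

excess-row-++ : ∀ t μ α ν β → excess t (row μ α ++ row ν β) ≡ rowExcess t (rowPairs μ α ++ rowPairs ν β)
excess-row-++ t μ α ν β = begin-equality
  excess t (row μ α ++ row ν β)                           ≡⟨ excess-++ t (row μ α) (row ν β) ⟩
  excess t (row μ α) + excess t (row ν β)                 ≡⟨ cong₂ _+_ (excess-row t μ α) (excess-row t ν β) ⟩
  rowExcess t (rowPairs μ α) + rowExcess t (rowPairs ν β) ≡⟨ excess-++ t (map diff (rowPairs μ α)) _ ⟨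
  excess t (map diff (rowPairs μ α) ++ map diff (rowPairs ν β))
                                                          ≡⟨ cong (excess t) (map-++ diff (rowPairs μ α) _) ⟨
  rowExcess t (rowPairs μ α ++ rowPairs ν β)              ∎
  where open ≤-Reasoning

sum-⊆ₚ[] : ∀ α → α ⊆ₚ [] → sum α ≡ 0
sum-⊆ₚ[] []      _    = refl
sum-⊆ₚ[] (a ∷ α) α⊆[] = cong₂ _+_ (n≤0⇒n≡0 (α⊆[] 0)) (sum-⊆ₚ[] α (α⊆[] ∘ suc))

rowExcess-rowPairs+sum : ∀ μ α → α ⊆ₚ μ → rowExcess 0 (rowPairs μ α) + sum α ≡ sum μ
rowExcess-rowPairs+sum []      α       α⊆[] = sum-⊆ₚ[] α α⊆[]
rowExcess-rowPairs+sum (m ∷ μ) []      _    =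
  trans (+-assoc m _ 0) (cong (m +_) (rowExcess-rowPairs+sum μ [] (λ _ → z≤n)))
rowExcess-rowPairs+sum (m ∷ μ) (a ∷ α) α⊆μ  = begin-equality
  ((m ∸ a) + rowExcess 0 (rowPairs μ α)) + (a + sum α)   ≡⟨ interchange (m ∸ a) _ a (sum α) ⟩
  ((m ∸ a) + a) + (rowExcess 0 (rowPairs μ α) + sum α)   ≡⟨ cong₂ _+_ (m∸n+n≡m (α⊆μ 0))
                                                                      (rowExcess-rowPairs+sum μ α (α⊆μ ∘ suc)) ⟩
  m + sum μ                                              ∎
  where open ≤-Reasoning

sum-row+sum : ∀ μ α → α ⊆ₚ μ → sum (row μ α) + sum α ≡ sum μ
sum-row+sum μ α α⊆μ =
  trans (cong (_+ sum α) (trans (sym (excess-zero (row μ α))) (excess-row 0 μ α)))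
        (rowExcess-rowPairs+sum μ α α⊆μ)

insertDesc-↭ : ∀ x l → insertDesc x l ↭ x ∷ l
insertDesc-↭ x l = subst (_↭ x ∷ l) (sym (insertDesc≡insert x l)) (insert-↭ x l)

insertDesc-head : ∀ {x} xs → Decreasing (x ∷ xs) → insertDesc x xs ≡ x ∷ xs
insertDesc-head {x} []       _           = refl
insertDesc-head {x} (y ∷ xs) (y≤x ∷ _) with y ≤? x
... | yes _   = refl
... | no y≰x  = contradiction y≤x y≰x

rowExcess-rowPairs-[] : ∀ t G → rowExcess t (rowPairs G []) ≡ excess t G
rowExcess-rowPairs-[] t []      = refl
rowExcess-rowPairs-[] t (g ∷ G) = cong ((g ∸ t) +_) (rowExcess-rowPairs-[] t G)

pair-exchange : ∀ t {g x d y} → x ≤ g → d ≤ y →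
                ((g ∸ y) ∸ t) + ((x ∸ d) ∸ t) ≤ ((g ∸ d) ∸ t) + ((x ∸ y) ∸ t)
pair-exchange t {g} {x} {d} {y} x≤g d≤y
  rewrite ∸-+-assoc g y t | ∸-+-assoc x d t | ∸-+-assoc g d t | ∸-+-assoc x y t =
  ∸-exchange x≤g (+-monoˡ-≤ t d≤y)

-- The shape of every inductive step of insert-rowExcess: the head pairs are exchanged, and
-- the rest is bounded by the recursive call.
exchange-with-rest : ∀ {a b X} e f S → a + b ≤ f + e → X ≤ b + S → a + X ≤ e + (f + S)
exchange-with-rest {a} {b} {X} e f S exchange rest = begin
  a + X          ≤⟨ +-monoʳ-≤ a rest ⟩
  a + (b + S)    ≡⟨ +-assoc a b S ⟨
  (a + b) + S    ≤⟨ +-monoˡ-≤ S exchange ⟩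
  (f + e) + S    ≡⟨ xy∙z≈y∙xz f e S ⟩
  e + (f + S)    ∎
  where open ≤-Reasoning

insert-rowExcess : ∀ t g d G D → Decreasing G → Decreasing D →
  rowExcess t (rowPairs (insertDesc g G) (insertDesc d D)) ≤ ((g ∸ d) ∸ t) + rowExcess t (rowPairs G D)
insert-rowExcess t g d [] [] _ _ = ≤-refl
insert-rowExcess t g d [] (y ∷ ys) _ _ with y ≤? d
... | yes _  = ≤-refl
... | no y≰d = +-monoˡ-≤ 0 (∸-monoˡ-≤ t (∸-monoʳ-≤ g (<⇒≤ (≰⇒> y≰d))))
insert-rowExcess t g d (x ∷ xs) [] _ _ with x ≤? g
... | yes _  = ≤-refl
... | no x≰g = exchange-with-rest ((g ∸ d) ∸ t) (x ∸ t) (rowExcess t (rowPairs xs []))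
  (pair-exchange t {y = d} (<⇒≤ (≰⇒> x≰g)) z≤n) (≤-reflexive (begin-equality
    rowExcess t (rowPairs (insertDesc g xs) [])   ≡⟨ rowExcess-rowPairs-[] t (insertDesc g xs) ⟩
    excess t (insertDesc g xs)                    ≡⟨ excess-↭ t (insertDesc-↭ g xs) ⟩
    (g ∸ t) + excess t xs                         ≡⟨ cong ((g ∸ t) +_) (rowExcess-rowPairs-[] t xs) ⟨
    (g ∸ t) + rowExcess t (rowPairs xs [])        ∎))
  where open ≤-Reasoning
insert-rowExcess t g d (x ∷ xs) (y ∷ ys) decG decD with x ≤? g | y ≤? d
... | yes _   | yes _   = ≤-refl
... | yes x≤g | no y≰d  = exchange-with-rest ((g ∸ d) ∸ t) ((x ∸ y) ∸ t) rest
    (subst (((g ∸ y) ∸ t) + ((x ∸ d) ∸ t) ≤_) (+-comm ((g ∸ d) ∸ t) ((x ∸ y) ∸ t))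
      (pair-exchange t x≤g (<⇒≤ (≰⇒> y≰d))))
    (subst (λ G → rowExcess t (rowPairs G (insertDesc d ys)) ≤ ((x ∸ d) ∸ t) + rest) (insertDesc-head xs decG)
      (insert-rowExcess t x d xs ys (Linked.tail decG) (Linked.tail decD)))
  where
  rest : ℕ
  rest = rowExcess t (rowPairs xs ys)
... | no x≰g  | yes y≤d = exchange-with-rest ((g ∸ d) ∸ t) ((x ∸ y) ∸ t) rest
    (pair-exchange t (<⇒≤ (≰⇒> x≰g)) y≤d)
    (subst (λ D → rowExcess t (rowPairs (insertDesc g xs) D) ≤ ((g ∸ y) ∸ t) + rest) (insertDesc-head ys decD)
      (insert-rowExcess t g y xs ys (Linked.tail decG) (Linked.tail decD)))
  where
  rest : ℕ
  rest = rowExcess t (rowPairs xs ys)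
... | no _    | no _    = exchange-with-rest ((g ∸ d) ∸ t) ((x ∸ y) ∸ t) (rowExcess t (rowPairs xs ys))
    ≤-refl (insert-rowExcess t g d xs ys (Linked.tail decG) (Linked.tail decD))

insertDesc-0 : ∀ {D} → All (0 <_) D → insertDesc 0 D ≡ D ++ [ 0 ]
insertDesc-0 []                     = refl
insertDesc-0 {suc y ∷ D} (_ ∷ pos) = cong (suc y ∷_) (insertDesc-0 pos)

rowPairs-++-0 : ∀ G D → rowPairs G (D ++ [ 0 ]) ≡ rowPairs G D
rowPairs-++-0 []      D       = refl
rowPairs-++-0 (g ∷ G) []      = refl
rowPairs-++-0 (g ∷ G) (d ∷ D) = cong ((g , d) ∷_) (rowPairs-++-0 G D)

sortDesc-nonzero-positive : ∀ l → All (0 <_) (sortDesc (nonzero l))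
sortDesc-nonzero-positive l = All-resp-↭ (↭-sym (sortDesc-↭ (nonzero l))) (all-filter (1 ≤?_) l)

sorted-pairing-rowExcess≤ : ∀ t P →
  rowExcess t (rowPairs (sortDesc (map proj₁ P)) (sortDesc (nonzero (map proj₂ P)))) ≤ rowExcess t P
sorted-pairing-rowExcess≤ t [] = z≤n
-- nonzero drops a zero second coordinate; inserting it into D would only append it.
sorted-pairing-rowExcess≤ t ((g , zero) ∷ P) = begin
  rowExcess t (rowPairs (insertDesc g G) D)
    ≡⟨ cong (rowExcess t) (rowPairs-++-0 (insertDesc g G) D) ⟨
  rowExcess t (rowPairs (insertDesc g G) (D ++ [ 0 ]))
    ≡⟨ cong (rowExcess t ∘ rowPairs (insertDesc g G)) (insertDesc-0 (sortDesc-nonzero-positive (map proj₂ P))) ⟨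
  rowExcess t (rowPairs (insertDesc g G) (insertDesc 0 D))
    ≤⟨ insert-rowExcess t g 0 G D (sortDesc-decreasing (map proj₁ P))
                                  (sortDesc-decreasing (nonzero (map proj₂ P))) ⟩
  (g ∸ t) + rowExcess t (rowPairs G D)
    ≤⟨ +-monoʳ-≤ (g ∸ t) (sorted-pairing-rowExcess≤ t P) ⟩
  (g ∸ t) + rowExcess t P
    ∎
  where
  open ≤-Reasoning
  G D : List ℕ
  G = sortDesc (map proj₁ P)
  D = sortDesc (nonzero (map proj₂ P))
sorted-pairing-rowExcess≤ t ((g , suc d) ∷ P) =
  ≤-trans (insert-rowExcess t g (suc d) (sortDesc (map proj₁ P)) (sortDesc (nonzero (map proj₂ P)))
                            (sortDesc-decreasing (map proj₁ P)) (sortDesc-decreasing (nonzero (map proj₂ P))))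
          (+-monoʳ-≤ ((g ∸ suc d) ∸ t) (sorted-pairing-rowExcess≤ t P))

map-proj₁-rowPairs : ∀ μ α → map proj₁ (rowPairs μ α) ≡ μ
map-proj₁-rowPairs []      α       = refl
map-proj₁-rowPairs (m ∷ μ) []      = cong (m ∷_) (map-proj₁-rowPairs μ [])
map-proj₁-rowPairs (m ∷ μ) (a ∷ α) = cong (m ∷_) (map-proj₁-rowPairs μ α)

nonzero-map-proj₂-rowPairs : ∀ μ α → All (0 <_) α → α ⊆ₚ μ → nonzero (map proj₂ (rowPairs μ α)) ≡ α
nonzero-map-proj₂-rowPairs []      []            _           _   = refl
nonzero-map-proj₂-rowPairs []      (a ∷ α)       (0<a ∷ _)   α⊆μ = contradiction (α⊆μ 0) (<⇒≱ 0<a)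
nonzero-map-proj₂-rowPairs (m ∷ μ) []            _           _   = nonzero-map-proj₂-rowPairs μ [] [] (λ _ → z≤n)
nonzero-map-proj₂-rowPairs (m ∷ μ) (suc a ∷ α)   (_ ∷ pos)   α⊆μ =
  cong (suc a ∷_) (nonzero-map-proj₂-rowPairs μ α pos (α⊆μ ∘ suc))

row-dominance : ∀ μ α ν β → All (0 <_) α → All (0 <_) β → α ⊆ₚ μ → β ⊆ₚ ν →
  (row (tildeL μ ν) (tildeL α β) ∪ₚ row (tildeR μ ν) (tildeR α β)) ⪯ (row μ α ∪ₚ row ν β)
row-dominance μ α ν β posα posβ α⊆μ β⊆ν =
  ⪯-from-excess (row (odds γ) (odds δ) ++ row (evens γ) (evens δ)) (row μ α ++ row ν β) sum≡ excess≤
  where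
  γ δ : List ℕ
  γ = μ ∪ₚ ν
  δ = α ∪ₚ β
  P : List (ℕ × ℕ)
  P = rowPairs μ α ++ rowPairs ν β

  sorted-pairing : rowPairs (sortDesc (map proj₁ P)) (sortDesc (nonzero (map proj₂ P))) ≡ rowPairs γ δ
  sorted-pairing = cong₂ (λ xs ys → rowPairs (sortDesc xs) (sortDesc ys))
    (trans (map-++ proj₁ (rowPairs μ α) _) (cong₂ _++_ (map-proj₁-rowPairs μ α) (map-proj₁-rowPairs ν β)))
    (trans (cong nonzero (map-++ proj₂ (rowPairs μ α) _))
      (trans (filter-++ (1 ≤?_) (map proj₂ (rowPairs μ α)) _)
        (cong₂ _++_ (nonzero-map-proj₂-rowPairs μ α posα α⊆μ) (nonzero-map-proj₂-rowPairs ν β posβ β⊆ν))))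

  excess≤ : ∀ t → excess t (row (odds γ) (odds δ) ++ row (evens γ) (evens δ)) ≤ excess t (row μ α ++ row ν β)
  excess≤ t = begin
    excess t (row (odds γ) (odds δ) ++ row (evens γ) (evens δ))
      ≡⟨ excess-row-++ t (odds γ) (odds δ) (evens γ) (evens δ) ⟩
    rowExcess t (rowPairs (odds γ) (odds δ) ++ rowPairs (evens γ) (evens δ))
      ≡⟨ excess-↭ t (map⁺ diff (rowPairs-odds++evens-↭ γ δ)) ⟩
    rowExcess t (rowPairs γ δ)
      ≡⟨ cong (rowExcess t) sorted-pairing ⟨
    rowExcess t (rowPairs (sortDesc (map proj₁ P)) (sortDesc (nonzero (map proj₂ P))))
      ≤⟨ sorted-pairing-rowExcess≤ t P ⟩
    rowExcess t P
      ≡⟨ excess-row-++ t μ α ν β ⟨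
    excess t (row μ α ++ row ν β)
      ∎
    where open ≤-Reasoning

  sum≡ : sum (row (odds γ) (odds δ) ++ row (evens γ) (evens δ)) ≡ sum (row μ α ++ row ν β)
  sum≡ = trans (sum-++ (row (odds γ) (odds δ)) _) (trans
    (tilde-difference-sum sum (λ μ α → sum (row μ α)) sum-++ sum-↭ sum-row+sum μ α ν β α⊆μ β⊆ν)
    (sym (sum-++ (row μ α) _)))

-- Columns

excess-upTo-stable : ∀ t (f : ℕ → ℕ) {m n} → (∀ k → m ≤ k → f k ≡ 0) → m ≤′ n →
                     excess t (map f (upTo n)) ≡ excess t (map f (upTo m))
excess-upTo-stable t f vanish ≤′-refl = refl
excess-upTo-stable t f {m} vanish (≤′-step {n} m≤′n) = begin-equality
  excess t (map f (upTo (suc n)))                ≡⟨ cong (excess t ∘ map f) (upTo-∷ʳ n) ⟨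
  excess t (map f (upTo n ++ [ n ]))             ≡⟨ cong (excess t) (map-++ f (upTo n) [ n ]) ⟩
  excess t (map f (upTo n) ++ [ f n ])           ≡⟨ excess-++ t (map f (upTo n)) [ f n ] ⟩
  excess t (map f (upTo n)) + ((f n ∸ t) + 0)    ≡⟨ cong (λ z → excess t (map f (upTo n)) + ((z ∸ t) + 0))
                                                         (vanish n (≤′⇒≤ m≤′n)) ⟩
  excess t (map f (upTo n)) + ((0 ∸ t) + 0)      ≡⟨ cong (λ z → excess t (map f (upTo n)) + (z + 0)) (0∸n≡0 t) ⟩
  excess t (map f (upTo n)) + 0                  ≡⟨ +-identityʳ _ ⟩
  excess t (map f (upTo n))                      ≡⟨ excess-upTo-stable t f vanish m≤′n ⟩
  excess t (map f (upTo m))                      ∎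
  where open ≤-Reasoning

excess-upTo-vanishing : ∀ t (f : ℕ → ℕ) {m n} → (∀ k → m ≤ k → f k ≡ 0) → (∀ k → n ≤ k → f k ≡ 0) →
                        excess t (map f (upTo m)) ≡ excess t (map f (upTo n))
excess-upTo-vanishing t f {m} {n} vanish-m vanish-n with ≤-total m n
... | inj₁ m≤n = sym (excess-upTo-stable t f vanish-m (≤⇒≤′ m≤n))
... | inj₂ n≤m = excess-upTo-stable t f vanish-n (≤⇒≤′ n≤m)

colLen-vanishes : ∀ μ α → α ⊆ₚ μ → conj μ (suc k) ≡ 0 → colLen μ α (suc k) ≡ 0
colLen-vanishes {k} μ α α⊆μ conj≡0 = m+n≡0⇒m≡0 _ (trans (colLen+conj μ α α⊆μ k) conj≡0)

excess-col : ∀ t μ α N → Decreasing μ → α ⊆ₚ μ → (∀ k → N ≤ k → conj μ (suc k) ≡ 0) →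
             excess t (col μ α) ≡ excess t (map (λ k → colLen μ α (suc k)) (upTo N))
excess-col t μ α N dec α⊆μ vanish-N = begin-equality
  excess t (col μ α)                               ≡⟨ excess-↭ t (sortDesc-↭ (nonzero columns)) ⟩
  excess t (nonzero columns)                       ≡⟨ excess-nonzero t columns ⟩
  excess t columns
    ≡⟨ excess-upTo-vanishing t (λ k → colLen μ α (suc k))
         (λ k head≤k → colLen-vanishes μ α α⊆μ (conj-vanishes dec head≤k))
         (λ k N≤k → colLen-vanishes μ α α⊆μ (vanish-N k N≤k)) ⟩
  excess t (map (λ k → colLen μ α (suc k)) (upTo N)) ∎
  where
  open ≤-Reasoning
  columns : List ℕ
  columns = map (λ k → colLen μ α (suc k)) (upTo (part μ 0))

excess-map+excess-map : ∀ t (f g : ℕ → ℕ) xs →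
  excess t (map f xs) + excess t (map g xs) ≡ sum (map (λ x → (f x ∸ t) + (g x ∸ t)) xs)
excess-map+excess-map t f g []       = refl
excess-map+excess-map t f g (x ∷ xs) =
  trans (interchange (f x ∸ t) _ (g x ∸ t) _) (cong ((f x ∸ t) + (g x ∸ t) +_) (excess-map+excess-map t f g xs))

sum-map-mono : ∀ {F G : ℕ → ℕ} → (∀ x → F x ≤ G x) → ∀ xs → sum (map F xs) ≤ sum (map G xs)
sum-map-mono F≤G []       = z≤n
sum-map-mono F≤G (x ∷ xs) = +-mono-≤ (F≤G x) (sum-map-mono F≤G xs)

excess-col-++ : ∀ t N P Q P′ Q′ → Decreasing P → Decreasing P′ → Q ⊆ₚ P → Q′ ⊆ₚ P′ →
  (∀ k → N ≤ k → conj P (suc k) + conj P′ (suc k) ≡ 0) →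
  excess t (col P Q ++ col P′ Q′) ≡
  sum (map (λ k → (colLen P Q (suc k) ∸ t) + (colLen P′ Q′ (suc k) ∸ t)) (upTo N))
excess-col-++ t N P Q P′ Q′ dec dec′ Q⊆P Q′⊆P′ vanish-N = begin-equality
  excess t (col P Q ++ col P′ Q′)
    ≡⟨ excess-++ t (col P Q) (col P′ Q′) ⟩
  excess t (col P Q) + excess t (col P′ Q′)
    ≡⟨ cong₂ _+_ (excess-col t P Q N dec Q⊆P (λ k N≤k → m+n≡0⇒m≡0 _ (vanish-N k N≤k)))
                 (excess-col t P′ Q′ N dec′ Q′⊆P′ (λ k N≤k → m+n≡0⇒n≡0 _ (vanish-N k N≤k))) ⟩
  excess t (map (λ k → colLen P Q (suc k)) (upTo N)) + excess t (map (λ k → colLen P′ Q′ (suc k)) (upTo N))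
    ≡⟨ excess-map+excess-map t (λ k → colLen P Q (suc k)) (λ k → colLen P′ Q′ (suc k)) (upTo N) ⟩
  sum (map (λ k → (colLen P Q (suc k) ∸ t) + (colLen P′ Q′ (suc k) ∸ t)) (upTo N))
    ∎
  where open ≤-Reasoning

conj-beyond-∪ₚ-head : ∀ μ ν k → part (μ ∪ₚ ν) 0 ≤ k → conj μ (suc k) + conj ν (suc k) ≡ 0
conj-beyond-∪ₚ-head μ ν k head≤k = begin-equality
  conj μ (suc k) + conj ν (suc k)   ≡⟨ conj-++ (suc k) μ ν ⟨
  conj (μ ++ ν) (suc k)             ≡⟨ conj-↭ (suc k) (sortDesc-↭ (μ ++ ν)) ⟨
  conj (μ ∪ₚ ν) (suc k)             ≡⟨ conj-vanishes (sortDesc-decreasing (μ ++ ν)) head≤k ⟩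
  0                                 ∎
  where open ≤-Reasoning

conj-tilde-beyond-∪ₚ-head : ∀ μ ν k → part (μ ∪ₚ ν) 0 ≤ k →
                            conj (tildeL μ ν) (suc k) + conj (tildeR μ ν) (suc k) ≡ 0
conj-tilde-beyond-∪ₚ-head μ ν k head≤k = begin-equality
  conj (tildeL μ ν) (suc k) + conj (tildeR μ ν) (suc k)   ≡⟨ conj-++ (suc k) (tildeL μ ν) (tildeR μ ν) ⟨
  conj (tildeL μ ν ++ tildeR μ ν) (suc k)                 ≡⟨ conj-↭ (suc k) (tilde-↭ μ ν) ⟩
  conj (μ ++ ν) (suc k)                                   ≡⟨ conj-++ (suc k) μ ν ⟩
  conj μ (suc k) + conj ν (suc k)                         ≡⟨ conj-beyond-∪ₚ-head μ ν k head≤k ⟩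
  0                                                       ∎
  where open ≤-Reasoning

colLen-odds-evens-near-balanced : ∀ γ δ → Decreasing γ → Decreasing δ → δ ⊆ₚ γ → ∀ j →
  colLen (odds γ) (odds δ) (suc j) ≤ suc (colLen (evens γ) (evens δ) (suc j)) ×
  colLen (evens γ) (evens δ) (suc j) ≤ suc (colLen (odds γ) (odds δ) (suc j))
colLen-odds-evens-near-balanced γ δ decγ decδ δ⊆γ j =
  differences-near-balanced (colLen (odds γ) (odds δ) (suc j)) (colLen (evens γ) (evens δ) (suc j))
                            (conj (odds δ) (suc j)) (conj (evens δ) (suc j))
    (colLen+conj (odds γ) (odds δ) (odds-mono-⊆ₚ δ γ δ⊆γ) j)
    (colLen+conj (evens γ) (evens δ) (evens-mono-⊆ₚ δ γ δ⊆γ) j)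
    (proj₁ (conj-odds-evens-balanced decγ (suc j))) (proj₂ (conj-odds-evens-balanced decγ (suc j)))
    (proj₁ (conj-odds-evens-balanced decδ (suc j))) (proj₂ (conj-odds-evens-balanced decδ (suc j)))

col-dominance : ∀ μ α ν β → Decreasing μ → Decreasing ν → α ⊆ₚ μ → β ⊆ₚ ν →
  (col (tildeL μ ν) (tildeL α β) ∪ₚ col (tildeR μ ν) (tildeR α β)) ⪯ (col μ α ∪ₚ col ν β)
col-dominance μ α ν β decμ decν α⊆μ β⊆ν =
  ⪯-from-excess (col L S ++ col R T) (col μ α ++ col ν β) sum≡ excess≤
  where
  L R S T : List ℕ
  L = tildeL μ ν
  R = tildeR μ ν
  S = tildeL α β
  T = tildeR α β
  N : ℕ
  N = part (μ ∪ₚ ν) 0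

  column-sum : ∀ k → colLen L S (suc k) + colLen R T (suc k) ≡ colLen μ α (suc k) + colLen ν β (suc k)
  column-sum k = tilde-difference-sum (λ l → conj l (suc k)) (λ P Q → colLen P Q (suc k))
    (conj-++ (suc k)) (conj-↭ (suc k)) (λ P Q Q⊆P → colLen+conj P Q Q⊆P k) μ α ν β α⊆μ β⊆ν

  column≤ : ∀ t k → (colLen L S (suc k) ∸ t) + (colLen R T (suc k) ∸ t) ≤
                    (colLen μ α (suc k) ∸ t) + (colLen ν β (suc k) ∸ t)
  column≤ t k = ∸-near-balanced t (column-sum k) (proj₁ balanced) (proj₂ balanced)
    where
    balanced : colLen L S (suc k) ≤ suc (colLen R T (suc k)) × colLen R T (suc k) ≤ suc (colLen L S (suc k))
    balanced = colLen-odds-evens-near-balanced (μ ∪ₚ ν) (α ∪ₚ β) (sortDesc-decreasing (μ ++ ν))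
                 (sortDesc-decreasing (α ++ β)) (∪ₚ-mono-⊆ₚ α β μ ν α⊆μ β⊆ν) k

  excess-tilde : ∀ t → excess t (col L S ++ col R T) ≡
                       sum (map (λ k → (colLen L S (suc k) ∸ t) + (colLen R T (suc k) ∸ t)) (upTo N))
  excess-tilde t = excess-col-++ t N L S R T (odds-decreasing (sortDesc-decreasing (μ ++ ν)))
    (evens-decreasing (sortDesc-decreasing (μ ++ ν))) (tildeL-mono-⊆ₚ α β μ ν α⊆μ β⊆ν)
    (tildeR-mono-⊆ₚ α β μ ν α⊆μ β⊆ν) (conj-tilde-beyond-∪ₚ-head μ ν)

  excess-original : ∀ t → excess t (col μ α ++ col ν β) ≡
                          sum (map (λ k → (colLen μ α (suc k) ∸ t) + (colLen ν β (suc k) ∸ t)) (upTo N))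
  excess-original t = excess-col-++ t N μ α ν β decμ decν α⊆μ β⊆ν (conj-beyond-∪ₚ-head μ ν)

  excess≤ : ∀ t → excess t (col L S ++ col R T) ≤ excess t (col μ α ++ col ν β)
  excess≤ t = subst₂ _≤_ (sym (excess-tilde t)) (sym (excess-original t)) (sum-map-mono (column≤ t) (upTo N))

  sum≡ : sum (col L S ++ col R T) ≡ sum (col μ α ++ col ν β)
  sum≡ = begin-equality
    sum (col L S ++ col R T)        ≡⟨ excess-zero (col L S ++ col R T) ⟨
    excess 0 (col L S ++ col R T)   ≡⟨ excess-tilde 0 ⟩
    sum (map (λ k → colLen L S (suc k) + colLen R T (suc k)) (upTo N))
                                    ≡⟨ cong sum (map-cong column-sum (upTo N)) ⟩
    sum (map (λ k → colLen μ α (suc k) + colLen ν β (suc k)) (upTo N))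
                                    ≡⟨ excess-original 0 ⟨
    excess 0 (col μ α ++ col ν β)   ≡⟨ excess-zero (col μ α ++ col ν β) ⟩
    sum (col μ α ++ col ν β)        ∎
    where open ≤-Reasoning

lemma5p4 : (μ α ν β : List ℕ) →
    IsPartition μ → IsPartition α → IsPartition ν → IsPartition β →
    α ⊆ₚ μ → β ⊆ₚ ν →
    ((row (tildeL μ ν) (tildeL α β) ∪ₚ row (tildeR μ ν) (tildeR α β))
        ⪯ (row μ α ∪ₚ row ν β))
    × ((col (tildeL μ ν) (tildeL α β) ∪ₚ col (tildeR μ ν) (tildeR α β))
        ⪯ (col μ α ∪ₚ col ν β))
lemma5p4 μ α ν β (decμ , _) (_ , posα) (decν , _) (_ , posβ) α⊆μ β⊆ν =
  row-dominance μ α ν β posα posβ α⊆μ β⊆ν , col-dominance μ α ν β decμ decν α⊆μ β⊆ν
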